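{- For every integer $b \geq 3$, $N(1,b;2) \geq 2b^2+5b+6$; that is, there is a 2-coloring of $[1,2b^2+5b+5]$ containing no monochromatic $(1,b)$-triple.
   Context: $\mathbf{N}=\{1,2,3,\dots\}$ and $[1,n]=\{1,2,\dots,n\}$. For integers $1 \leq a \leq b$, an $(a,b)$-triple is a set of the form $\{x,ax+d,bx+2d\}$ with $x,d \in \mathbf{N}$; so a $(1,b)$-triple is $\{x,x+d,bx+2d\}$. $N(a,b;r)$ is the least positive integer, if it exists, such that every $r$-coloring of $[1,N(a,b;r)]$ contains a monochromatic $(a,b)$-triple. -}

module Defs where

open import Data.Nat using (ℕ; _+_; _*_; _≤_)
open import Data.Bool using (Bool)
open import Data.Product using (Σ; ∃; _×_)
open import Relation.Binary.PropositionalEquality using (_≡_)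

-- A 2-coloring of [1,n] is represented as a function ℕ → Bool;
-- only its values on [1,n] are ever inspected.
Coloring₂ : Set
Coloring₂ = ℕ → Bool

MonoTriple : (a b n : ℕ) → Coloring₂ → Set
MonoTriple a b n χ =
  Σ ℕ λ x → Σ ℕ λ d →
    (1 ≤ x) × (1 ≤ d) × (a * x + d ≤ n) × (b * x + 2 * d ≤ n) ×
    (χ x ≡ χ (a * x + d)) × (χ x ≡ χ (b * x + 2 * d))

-- Colour blue the set {b+2} ∪ [b+4, K] with K = b² + 2b + 3, and red the rest of [1, N].
-- For a triple x < w = x + d < z = b x + 2 d write z = (b − 2) x + 2 w, which is
-- increasing in x and w.  A blue triple has x ≥ b + 2, hence w ≥ b + 4 and
-- z ≥ (b − 2)(b + 2) + 2(b + 4) = K + 1, so z is red.  In a red triple z ≤ N forces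
-- w ≤ K, hence w ≤ b + 3 and x ≤ b + 1; then b + 2 ≤ z ≤ (b − 2)(b + 1) + 2(b + 3) ≤ K,
-- so z would have to be the red point b + 3, i.e. x = 1 and 2 d = 3.
module Submission where

open import Defs
open import Data.Nat using (ℕ; zero; suc; _+_; _*_; _≤_; _<_; z≤n; s≤s)
open import Data.Nat.Properties
open import Data.Nat.Tactic.RingSolver using (solve-∀)
open import Data.Bool using (true; false)
open import Data.Empty using (⊥-elim)
open import Data.Product using (Σ; _,_; _×_; proj₁; proj₂)
open import Data.Sum using (_⊎_; inj₁; inj₂)
open import Relation.Nullary using (¬_; yes; no)
open import Relation.Binary.PropositionalEquality

linear-mono : ∀ c {x x′ w w′} → x ≤ x′ → w ≤ w′ → c * x + 2 * w ≤ c * x′ + 2 * w′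
linear-mono c x≤x′ w≤w′ = +-mono-≤ (*-monoʳ-≤ c x≤x′) (*-monoʳ-≤ 2 w≤w′)

top-via-middle : ∀ c x d → (2 + c) * x + 2 * d ≡ c * x + 2 * (x + d)
top-via-middle = solve-∀

-- The ring solver cannot see through b, K and N, so each polynomial identity below
-- (at-corner) is stated for a fresh n and used at n = e.
module Colouring (e : ℕ) where

  b K N : ℕ
  b = 3 + e
  K = b * b + 2 * b + 3
  N = 2 * (b * b) + 5 * b + 5

  data Blue : ℕ → Set where
    pivot  : Blue (2 + b)
    middle : ∀ {m} → 4 + b ≤ m → m ≤ K → Blue m

  data Red : ℕ → Set where
    low  : ∀ {m} → m ≤ 1 + b → Red m
    gap  : Red (3 + b)
    high : ∀ {m} → K < m → Red m

  classify : ∀ m → Blue m ⊎ Red m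
  classify m with m ≤? 1 + b
  ... | yes m≤1+b = inj₂ (low m≤1+b)
  ... | no m≰1+b with m ≟ 2 + b
  ... | yes refl = inj₁ pivot
  ... | no m≢2+b with m ≟ 3 + b
  ... | yes refl = inj₂ gap
  ... | no m≢3+b with m ≤? K
  ... | no m≰K = inj₂ (high (≰⇒> m≰K))
  ... | yes m≤K = inj₁ (middle 4+b≤m m≤K)
    where
    3+b≤m : 3 + b ≤ m
    3+b≤m = ≤∧≢⇒< (≰⇒> m≰1+b) (λ eq → m≢2+b (sym eq))
    4+b≤m : 4 + b ≤ m
    4+b≤m = ≤∧≢⇒< 3+b≤m (λ eq → m≢3+b (sym eq))

  χ : Coloring₂
  χ m with classify m
  ... | inj₁ _ = true
  ... | inj₂ _ = false

  monochromatic : ∀ x y z → χ x ≡ χ y → χ x ≡ χ z →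
                  (Blue x × Blue y × Blue z) ⊎ (Red x × Red y × Red z)
  monochromatic x y z χx≡χy χx≡χz with classify x | classify y | classify z
  ... | inj₁ bx | inj₁ by | inj₁ bz = inj₁ (bx , by , bz)
  ... | inj₂ rx | inj₂ ry | inj₂ rz = inj₂ (rx , ry , rz)
  ... | inj₁ _ | inj₂ _ | _ with () ← χx≡χy
  ... | inj₂ _ | inj₁ _ | _ with () ← χx≡χy
  ... | inj₁ _ | _ | inj₂ _ with () ← χx≡χz
  ... | inj₂ _ | _ | inj₁ _ with () ← χx≡χz

  3+b≤K : 3 + b ≤ K
  3+b≤K = begin
    3 + b             ≡⟨ +-comm 3 b ⟩
    b + 3             ≤⟨ +-monoˡ-≤ 3 (≤-trans (m≤m+n b (1 * b)) (m≤n+m (2 * b) (b * b))) ⟩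
    b * b + 2 * b + 3 ∎
    where open ≤-Reasoning

  blue-between : ∀ {m} → Blue m → 2 + b ≤ m × m ≤ K
  blue-between pivot = ≤-refl , ≤-trans (n≤1+n (2 + b)) 3+b≤K
  blue-between (middle 4+b≤m m≤K) = ≤-trans (m≤n+m (2 + b) 2) 4+b≤m , m≤K

  blue-above-pivot : ∀ {m} → Blue m → 2 + b < m → 4 + b ≤ m
  blue-above-pivot pivot 2+b<2+b = ⊥-elim (<-irrefl refl 2+b<2+b)
  blue-above-pivot (middle 4+b≤m _) _ = 4+b≤m

  red-below-K : ∀ {m} → Red m → m ≤ K → m ≤ 1 + b ⊎ m ≡ 3 + b
  red-below-K (low m≤1+b) _ = inj₁ m≤1+b
  red-below-K gap _ = inj₂ refl
  red-below-K (high K<m) m≤K = ⊥-elim (<⇒≱ K<m m≤K)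

  red-between : ∀ {m} → Red m → 2 + b ≤ m → m ≤ K → m ≡ 3 + b
  red-between (low m≤1+b) 2+b≤m _ = ⊥-elim (<⇒≱ 2+b≤m m≤1+b)
  red-between gap _ _ = refl
  red-between (high K<m) _ m≤K = ⊥-elim (<⇒≱ K<m m≤K)

  blue-top-exceeds : ∀ x d → 2 + b ≤ x → 4 + b ≤ x + d → K < b * x + 2 * d
  blue-top-exceeds x d 2+b≤x 4+b≤x+d = begin
    suc K                           ≡⟨ at-corner e ⟩
    (1 + e) * (2 + b) + 2 * (4 + b) ≤⟨ linear-mono (1 + e) 2+b≤x 4+b≤x+d ⟩
    (1 + e) * x + 2 * (x + d)       ≡⟨ top-via-middle (1 + e) x d ⟨
    b * x + 2 * d                   ∎
    where
    open ≤-Reasoning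
    at-corner : ∀ n → suc ((3 + n) * (3 + n) + 2 * (3 + n) + 3) ≡ (1 + n) * (5 + n) + 2 * (7 + n)
    at-corner = solve-∀

  high-top-exceeds : ∀ x d → 1 ≤ x → K < x + d → N < b * x + 2 * d
  high-top-exceeds x d 1≤x K<x+d = begin
    suc N                       ≡⟨ at-corner e ⟩
    (1 + e) * 1 + 2 * suc K     ≤⟨ linear-mono (1 + e) 1≤x K<x+d ⟩
    (1 + e) * x + 2 * (x + d)   ≡⟨ top-via-middle (1 + e) x d ⟨
    b * x + 2 * d               ∎
    where
    open ≤-Reasoning
    at-corner : ∀ n → suc (2 * ((3 + n) * (3 + n)) + 5 * (3 + n) + 5)
                    ≡ (1 + n) * 1 + 2 * suc ((3 + n) * (3 + n) + 2 * (3 + n) + 3)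
    at-corner = solve-∀

  low-top-bounded : ∀ x d → x ≤ 1 + b → x + d ≤ 3 + b → b * x + 2 * d ≤ K
  low-top-bounded x d x≤1+b x+d≤3+b = begin
    b * x + 2 * d                            ≡⟨ top-via-middle (1 + e) x d ⟩
    (1 + e) * x + 2 * (x + d)                ≤⟨ linear-mono (1 + e) x≤1+b x+d≤3+b ⟩
    (1 + e) * (1 + b) + 2 * (3 + b)          ≤⟨ m≤m+n _ (2 + e) ⟩
    (1 + e) * (1 + b) + 2 * (3 + b) + (2 + e) ≡⟨ at-corner e ⟩
    K                                        ∎
    where
    open ≤-Reasoning
    at-corner : ∀ n → (1 + n) * (4 + n) + 2 * (6 + n) + (2 + n) ≡ (3 + n) * (3 + n) + 2 * (3 + n) + 3
    at-corner = solve-∀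

  top-lower : ∀ x d → 1 ≤ x → 1 ≤ d → 2 + b ≤ b * x + 2 * d
  top-lower x d 1≤x 1≤d = begin
    2 + b         ≡⟨ +-comm 2 b ⟩
    b + 2         ≡⟨ cong (_+ 2) (*-identityʳ b) ⟨
    b * 1 + 2 * 1 ≤⟨ linear-mono b 1≤x 1≤d ⟩
    b * x + 2 * d ∎
    where open ≤-Reasoning

  top≢gap : ∀ x d → 1 ≤ x → 1 ≤ d → b * x + 2 * d ≢ 3 + b
  top≢gap (suc zero) d _ _ eq = even≢odd d 1 (+-cancelˡ-≡ b _ _ (begin
    b + 2 * d     ≡⟨ cong (_+ 2 * d) (*-identityʳ b) ⟨
    b * 1 + 2 * d ≡⟨ eq ⟩
    3 + b         ≡⟨ +-comm 3 b ⟩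
    b + 3         ∎))
    where open ≡-Reasoning
  top≢gap (suc (suc x)) d _ 1≤d eq = <⇒≢ 3+b<top (sym eq)
    where
    open ≤-Reasoning
    at-corner : ∀ n → 4 + (3 + n) + (1 + n) ≡ (3 + n) * 2 + 2 * 1
    at-corner = solve-∀
    3+b<top : 3 + b < b * suc (suc x) + 2 * d
    3+b<top = begin-strict
      3 + b               <⟨ n<1+n (3 + b) ⟩
      4 + b               ≤⟨ m≤m+n (4 + b) (1 + e) ⟩
      4 + b + (1 + e)     ≡⟨ at-corner e ⟩
      b * 2 + 2 * 1       ≤⟨ linear-mono b (m≤m+n 2 x) 1≤d ⟩
      b * suc (suc x) + 2 * d ∎

  no-blue-triple : ∀ x d → 1 ≤ d → Blue x → Blue (x + d) → ¬ Blue (b * x + 2 * d)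
  no-blue-triple x d 1≤d bx bw bz =
    <⇒≱ (blue-top-exceeds x d 2+b≤x 4+b≤x+d) (proj₂ (blue-between bz))
    where
    2+b≤x : 2 + b ≤ x
    2+b≤x = proj₁ (blue-between bx)
    4+b≤x+d : 4 + b ≤ x + d
    4+b≤x+d = blue-above-pivot bw (≤-<-trans 2+b≤x (m<m+n x 1≤d))

  no-red-triple : ∀ x d → 1 ≤ x → 1 ≤ d → b * x + 2 * d ≤ N →
                  Red x → Red (x + d) → ¬ Red (b * x + 2 * d)
  no-red-triple x d 1≤x 1≤d top≤N rx rw rz =
    top≢gap x d 1≤x 1≤d (red-between rz (top-lower x d 1≤x 1≤d) (low-top-bounded x d x≤1+b x+d≤3+b))
    where
    x<x+d : x < x + d
    x<x+d = m<m+n x 1≤d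
    x+d≤K : x + d ≤ K
    x+d≤K = ≮⇒≥ (λ K<x+d → <⇒≱ (high-top-exceeds x d 1≤x K<x+d) top≤N)
    x+d≤3+b : x + d ≤ 3 + b
    x+d≤3+b with red-below-K rw x+d≤K
    ... | inj₁ x+d≤1+b = ≤-trans x+d≤1+b (m≤n+m (1 + b) 2)
    ... | inj₂ x+d≡3+b = ≤-reflexive x+d≡3+b
    x≤1+b : x ≤ 1 + b
    x≤1+b with red-below-K rx (≤-trans (<⇒≤ x<x+d) x+d≤K)
    ... | inj₁ x≤1+b = x≤1+b
    ... | inj₂ x≡3+b = ⊥-elim (<⇒≱ (subst (_< x + d) x≡3+b x<x+d) x+d≤3+b)

  no-monochromatic-triple : ¬ MonoTriple 1 b N χ
  no-monochromatic-triple (x , d , 1≤x , 1≤d , _ , top≤N , χx≡χw , χx≡χz)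
    with monochromatic x (x + d) (b * x + 2 * d)
           (trans χx≡χw (cong (λ y → χ (y + d)) (*-identityˡ x))) χx≡χz
  ... | inj₁ (bx , bw , bz) = no-blue-triple x d 1≤d bx bw bz
  ... | inj₂ (rx , rw , rz) = no-red-triple x d 1≤x 1≤d top≤N rx rw rz

theorem2p5 : (b : ℕ) → 3 ≤ b →
    Σ Coloring₂ λ χ → ¬ MonoTriple 1 b (2 * (b * b) + 5 * b + 5) χ
theorem2p5 (suc (suc (suc e))) (s≤s (s≤s (s≤s z≤n))) = χ , no-monochromatic-triple
  where open Colouring e
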